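{- If $G$ is a $(P_3+P_1)$-free graph, then every linear coloring of $G$ is a centered coloring. In particular, $\chi_{\mathrm{lin}}(G)=\chi_{\mathrm{cen}}(G)$.
   Context: All graphs are finite and simple. $P_3+P_1$ is the disjoint union of a path on 3 vertices and a single vertex; $G$ is $(P_3+P_1)$-free if no induced subgraph of $G$ is isomorphic to $P_3+P_1$. A centered coloring of $G$ assigns integers (colors) to vertices so that every connected subgraph contains a vertex whose color is unique in that subgraph; $\chi_{\mathrm{cen}}(G)$ is the minimum number of colors of such a coloring. A linear coloring requires the same only for every path of $G$ (as a subgraph); $\chi_{\mathrm{lin}}(G)$ is the minimum number of colors of a linear coloring. -}

module Defs where

open import Data.Nat using (ℕ; _≤_)
open import Data.Fin using (toℕ)
open import Data.List.Relation.Unary.Linked using (Linked)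
open import Data.Fin using (Fin; zero; suc)
open import Data.Bool using (Bool; true; false; T)
open import Data.List using (List; []; _∷_)
open import Data.List.Membership.Propositional using (_∈_)
open import Data.List.Relation.Unary.Unique.Propositional using (Unique)
open import Data.Sum using (_⊎_)
open import Data.Product using (Σ; ∃; ∃-syntax; _×_; _,_)
open import Function.Definitions using (Injective)
open import Relation.Binary.PropositionalEquality using (_≡_)
open import Relation.Nullary using (¬_)

record Graph : Set where
  field
    n      : ℕ
    adj    : Fin n → Fin n → Bool
    sym    : ∀ u v → adj u v ≡ adj v u
    irrefl : ∀ v → adj v v ≡ false

open Graph public

V : Graph → Set
V G = Fin (n G)

Adj : (G : Graph) → V G → V G → Set
Adj G u v = T (adj G u v)

InducedSubgraphOf : Graph → Graph → Set
InducedSubgraphOf H G =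
  Σ (V H → V G) λ f → Injective _≡_ _≡_ f × (∀ u v → adj G (f u) (f v) ≡ adj H u v)

p3p1-adj : Fin 4 → Fin 4 → Bool
p3p1-adj zero (suc zero) = true
p3p1-adj (suc zero) zero = true
p3p1-adj (suc zero) (suc (suc zero)) = true
p3p1-adj (suc (suc zero)) (suc zero) = true
p3p1-adj _ _ = false

p3p1-sym : ∀ u v → p3p1-adj u v ≡ p3p1-adj v u
p3p1-sym zero zero = _≡_.refl
p3p1-sym zero (suc zero) = _≡_.refl
p3p1-sym zero (suc (suc zero)) = _≡_.refl
p3p1-sym zero (suc (suc (suc zero))) = _≡_.refl
p3p1-sym (suc zero) zero = _≡_.refl
p3p1-sym (suc zero) (suc zero) = _≡_.refl
p3p1-sym (suc zero) (suc (suc zero)) = _≡_.refl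
p3p1-sym (suc zero) (suc (suc (suc zero))) = _≡_.refl
p3p1-sym (suc (suc zero)) zero = _≡_.refl
p3p1-sym (suc (suc zero)) (suc zero) = _≡_.refl
p3p1-sym (suc (suc zero)) (suc (suc zero)) = _≡_.refl
p3p1-sym (suc (suc zero)) (suc (suc (suc zero))) = _≡_.refl
p3p1-sym (suc (suc (suc zero))) zero = _≡_.refl
p3p1-sym (suc (suc (suc zero))) (suc zero) = _≡_.refl
p3p1-sym (suc (suc (suc zero))) (suc (suc zero)) = _≡_.refl
p3p1-sym (suc (suc (suc zero))) (suc (suc (suc zero))) = _≡_.refl

p3p1-irrefl : ∀ v → p3p1-adj v v ≡ false
p3p1-irrefl zero = _≡_.refl
p3p1-irrefl (suc zero) = _≡_.refl
p3p1-irrefl (suc (suc zero)) = _≡_.refl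
p3p1-irrefl (suc (suc (suc zero))) = _≡_.refl

P3+P1 : Graph
P3+P1 = record { n = 4 ; adj = p3p1-adj ; sym = p3p1-sym ; irrefl = p3p1-irrefl }

P3+P1-free : Graph → Set
P3+P1-free G = ¬ InducedSubgraphOf P3+P1 G

record Subgraph (G : Graph) : Set where
  field
    inV    : V G → Bool
    inE    : V G → V G → Bool
    E⊆adj  : ∀ {u v} → T (inE u v) → Adj G u v
    E⊆V    : ∀ {u v} → T (inE u v) → T (inV u) × T (inV v)

open Subgraph public

data Walk {G : Graph} (H : Subgraph G) : V G → V G → Set where
  stay : ∀ {u} → Walk H u u
  step : ∀ {u w v} → (T (inE H u w) ⊎ T (inE H w u)) → Walk H w v → Walk H u v

Connected : {G : Graph} → Subgraph G → Set
Connected {G} H = (∃[ v ] T (inV H v)) × (∀ u v → T (inV H u) → T (inV H v) → Walk H u v)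

HasUniqueColor : {G : Graph} → (V G → ℕ) → (V G → Set) → Set
HasUniqueColor {G} c P = ∃[ v ] (P v × (∀ w → P w → c w ≡ c v → w ≡ v))

IsCentered : (G : Graph) → (V G → ℕ) → Set
IsCentered G c = (H : Subgraph G) → Connected H → HasUniqueColor {G} c (λ v → T (inV H v))

record Path (G : Graph) : Set where
  field
    verts    : List (V G)
    nonempty : ¬ (verts ≡ [])
    distinct : Unique verts
    linked   : Linked (Adj G) verts

open Path public

IsLinear : (G : Graph) → (V G → ℕ) → Set
IsLinear G c = (P : Path G) → HasUniqueColor {G} c (λ v → v ∈ verts P)

-- Colourings with at most k colours are maps into Fin k.
-- χ_cen(G) = k : there is a centered colouring with k colours, and none with fewer.
IsChiCen : Graph → ℕ → Set
IsChiCen G k =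
  (Σ (V G → Fin k) λ c → IsCentered G (λ v → toℕ (c v)))
  × (∀ m → (c : V G → Fin m) → IsCentered G (λ v → toℕ (c v)) → k ≤ m)

IsChiLin : Graph → ℕ → Set
IsChiLin G k =
  (Σ (V G → Fin k) λ c → IsLinear G (λ v → toℕ (c v)))
  × (∀ m → (c : V G → Fin m) → IsLinear G (λ v → toℕ (c v)) → k ≤ m)

{-# OPTIONS --safe #-}
module Submission where

-- A linear colouring is proper and colours no path ABAB.  In a (P3+P1)-free graph this
-- gives: if z has a twin z′ (another vertex of its colour), then any two neighbours y, y′
-- of z get distinct colours, since otherwise y – z – y′ plus z′ is an induced P3+P1.  Hence
-- if u, w, t all have twins, u – w – t is never an induced P3: the twin of w would be an
-- isolated fourth vertex.  In a connected subgraph H without a uniquely coloured vertex every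
-- vertex has a twin in H, so following walks V(H) is a clique; but then a vertex and its twin
-- are adjacent and equally coloured.  Centered colourings are linear in any graph, as paths
-- are connected subgraphs.

open import Defs
open import Data.Bool using (Bool; true; false; T; _∧_)
open import Data.Bool.Properties using (T-≡; T-∧; ¬-not)
open import Data.Fin using (Fin; _≟_)
open import Data.Fin.Patterns using (0F; 1F; 2F; 3F)
open import Data.Fin.Properties using (any?; all?)
open import Data.List using (List; []; _∷_)
open import Data.List.Membership.DecPropositional using (_∈?_)
open import Data.List.Membership.Propositional using (_∈_)
open import Data.List.Relation.Unary.All as All using (All; []; _∷_)
open import Data.List.Relation.Unary.AllPairs using ([]; _∷_)
open import Data.List.Relation.Unary.Any using (here; there)
open import Data.List.Relation.Unary.Linked using (Linked; [-]; _∷_)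
open import Data.Nat as ℕ using (ℕ)
open import Data.Nat.Properties using (≤-antisym)
open import Data.Product using (∃-syntax; _×_; _,_; proj₁; proj₂; map₂)
open import Data.Sum using (_⊎_; inj₁; inj₂; [_,_]; swap)
open import Function using (_∘_)
open import Function.Bundles using (Equivalence)
open import Relation.Binary.PropositionalEquality using (_≡_; _≢_; refl; subst; ≢-sym)
import Relation.Binary.PropositionalEquality as ≡
open import Relation.Nullary using (¬_; Dec; yes; no; contradiction)
open import Relation.Nullary.Decidable
  using (T?; ¬?; _×-dec_; _→-dec_; decidable-stable; isYes; toWitness; fromWitness)
open import Relation.Unary using (Decidable)

module _ (G : Graph) where

  Adj-sym : ∀ {u w} → Adj G u w → Adj G w u
  Adj-sym {u} {w} = subst T (sym G u w)

  Adj⇒≢ : ∀ {u w} → Adj G u w → u ≢ w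
  Adj⇒≢ {u} u~w refl = subst T (irrefl G u) u~w

  induced-P3+P1 : ∀ {a b d e} → Adj G a b → Adj G b d → ¬ Adj G a d → a ≢ d
                → ¬ Adj G e a → ¬ Adj G e b → ¬ Adj G e d → InducedSubgraphOf P3+P1 G
  induced-P3+P1 {a} {b} {d} {e} a~b b~d a≁d a≢d e≁a e≁b e≁d = f , f-injective , f-adj
    where
    f : Fin 4 → V G
    f 0F = a
    f 1F = b
    f 2F = d
    f 3F = e

    a≢b : a ≢ b
    a≢b = Adj⇒≢ a~b
    b≢d : b ≢ d
    b≢d = Adj⇒≢ b~d
    a≢e : a ≢ e
    a≢e refl = e≁b a~b
    b≢e : b ≢ e
    b≢e refl = e≁a (Adj-sym a~b)
    d≢e : d ≢ e
    d≢e refl = e≁b (Adj-sym b~d)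

    f-injective : ∀ {i j} → f i ≡ f j → i ≡ j
    f-injective {0F} {0F} _ = refl
    f-injective {0F} {1F} p = contradiction p a≢b
    f-injective {0F} {2F} p = contradiction p a≢d
    f-injective {0F} {3F} p = contradiction p a≢e
    f-injective {1F} {0F} p = contradiction p (≢-sym a≢b)
    f-injective {1F} {1F} _ = refl
    f-injective {1F} {2F} p = contradiction p b≢d
    f-injective {1F} {3F} p = contradiction p b≢e
    f-injective {2F} {0F} p = contradiction p (≢-sym a≢d)
    f-injective {2F} {1F} p = contradiction p (≢-sym b≢d)
    f-injective {2F} {2F} _ = refl
    f-injective {2F} {3F} p = contradiction p d≢e
    f-injective {3F} {0F} p = contradiction p (≢-sym a≢e)
    f-injective {3F} {1F} p = contradiction p (≢-sym b≢e)
    f-injective {3F} {2F} p = contradiction p (≢-sym d≢e)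
    f-injective {3F} {3F} _ = refl

    edge : ∀ {x y} → Adj G x y → adj G x y ≡ true
    edge = Equivalence.to T-≡
    non-edge : ∀ {x y} → ¬ Adj G x y → adj G x y ≡ false
    non-edge x≁y = ¬-not (x≁y ∘ Equivalence.from T-≡)

    f-adj : ∀ i j → adj G (f i) (f j) ≡ p3p1-adj i j
    f-adj 0F 0F = irrefl G a
    f-adj 0F 1F = edge a~b
    f-adj 0F 2F = non-edge a≁d
    f-adj 0F 3F = non-edge (e≁a ∘ Adj-sym)
    f-adj 1F 0F = edge (Adj-sym a~b)
    f-adj 1F 1F = irrefl G b
    f-adj 1F 2F = edge b~d
    f-adj 1F 3F = non-edge (e≁b ∘ Adj-sym)
    f-adj 2F 0F = non-edge (a≁d ∘ Adj-sym)
    f-adj 2F 1F = edge (Adj-sym b~d)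
    f-adj 2F 2F = irrefl G d
    f-adj 2F 3F = non-edge (e≁d ∘ Adj-sym)
    f-adj 3F 0F = non-edge e≁a
    f-adj 3F 1F = non-edge e≁b
    f-adj 3F 2F = non-edge e≁d
    f-adj 3F 3F = irrefl G e

module _ {G : Graph} {H : Subgraph G} where

  _++ʷ_ : ∀ {u w v} → Walk H u w → Walk H w v → Walk H u v
  stay     ++ʷ q = q
  step e p ++ʷ q = step e (p ++ʷ q)

  reverseʷ : ∀ {u v} → Walk H u v → Walk H v u
  reverseʷ stay       = stay
  reverseʷ (step e p) = reverseʷ p ++ʷ step (swap e) stay

module _ {G : Graph} (H : Subgraph G) where

  step⇒Adj : ∀ {u w} → T (inE H u w) ⊎ T (inE H w u) → Adj G u w
  step⇒Adj (inj₁ e) = E⊆adj H e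
  step⇒Adj (inj₂ e) = Adj-sym G (E⊆adj H e)

  step⇒inV : ∀ {u w} → T (inE H u w) ⊎ T (inE H w u) → T (inV H w)
  step⇒inV (inj₁ e) = proj₂ (E⊆V H e)
  step⇒inV (inj₂ e) = proj₁ (E⊆V H e)

module _ (G : Graph) where

  induced : (V G → Bool) → Subgraph G
  induced s = record
    { inV   = s
    ; inE   = λ u w → adj G u w ∧ (s u ∧ s w)
    ; E⊆adj = λ {u} {w} → proj₁ ∘ Equivalence.to (T-∧ {adj G u w})
    ; E⊆V   = λ {u} {w} → Equivalence.to (T-∧ {s u}) ∘ proj₂ ∘ Equivalence.to (T-∧ {adj G u w})
    }

  members : List (V G) → V G → Bool
  members xs v = isYes (_∈?_ _≟_ v xs)

  linked⇒walk : ∀ {s x xs y} → All (T ∘ s) (x ∷ xs) → Linked (Adj G) (x ∷ xs)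
              → y ∈ x ∷ xs → Walk (induced s) x y
  linked⇒walk _ _ (here refl) = stay
  linked⇒walk {s} {x} {_ ∷ _} (sx ∷ ss@(sy ∷ _)) (x~y ∷ l) (there y∈) =
    step (inj₁ (Equivalence.from T-∧ (x~y , Equivalence.from (T-∧ {s x}) (sx , sy))))
         (linked⇒walk ss l y∈)

  linked⇒connected : ∀ {xs} → xs ≢ [] → Linked (Adj G) xs → Connected (induced (members xs))
  linked⇒connected {[]}     xs≢[] _ = contradiction refl xs≢[]
  linked⇒connected {x ∷ xs} _     l =
    (x , fromWitness (here refl)) , λ u v u∈ v∈ → reverseʷ (walk u∈) ++ʷ walk v∈
    where
    walk : ∀ {y} → T (members (x ∷ xs) y) → Walk (induced (members (x ∷ xs))) x y
    walk y∈ = linked⇒walk (All.tabulate fromWitness) l (toWitness y∈)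

  centered⇒linear : ∀ {c} → IsCentered G c → IsLinear G c
  centered⇒linear centered P =
    let v , v∈P , unique = centered (induced (members (verts P)))
                                    (linked⇒connected (nonempty P) (linked P))
    in  v , toWitness v∈P , λ w → unique w ∘ fromWitness

module _ {G : Graph} (c : V G → ℕ) {S : V G → Set} (S? : Decidable S) where

  hasUniqueColor? : Dec (HasUniqueColor {G} c S)
  hasUniqueColor? = any? λ v → S? v ×-dec all? λ w → S? w →-dec c w ℕ.≟ c v →-dec w ≟ v

  ¬unique⇒twin : ¬ HasUniqueColor {G} c S → ∀ {u} → S u → ∃[ u′ ] S u′ × u′ ≢ u × c u′ ≡ c u
  ¬unique⇒twin ¬unique {u} u∈S with any? (λ w → S? w ×-dec c w ℕ.≟ c u ×-dec ¬? (w ≟ u))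
  ... | yes (w , w∈S , cw≡cu , w≢u) = w , w∈S , w≢u , cw≡cu
  ... | no ∄twin = contradiction (u , u∈S , unique) ¬unique
    where
    unique : ∀ w → S w → c w ≡ c u → w ≡ u
    unique w w∈S cw≡cu = decidable-stable (w ≟ u) λ w≢u → ∄twin (w , w∈S , cw≡cu , w≢u)

module LinearColouring (G : Graph) {c : V G → ℕ} (linear : IsLinear G c) where

  proper : ∀ {u w} → Adj G u w → c u ≢ c w
  proper {u} {w} u~w cu≡cw with linear record
    { verts    = u ∷ w ∷ []
    ; nonempty = λ ()
    ; distinct = (Adj⇒≢ G u~w ∷ []) ∷ [] ∷ []
    ; linked   = u~w ∷ [-]
    }
  ... | _ , here refl , unique         = Adj⇒≢ G u~w (≡.sym (unique w (there (here refl)) (≡.sym cu≡cw)))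
  ... | _ , there (here refl) , unique = Adj⇒≢ G u~w (unique u (here refl) cu≡cw)

  no-ABAB-path : ∀ {a b a′ b′} → Adj G a b → Adj G b a′ → Adj G a′ b′ → a ≢ a′ → b ≢ b′
               → c a ≡ c a′ → c b ≢ c b′
  no-ABAB-path {a} {b} {a′} {b′} a~b b~a′ a′~b′ a≢a′ b≢b′ ca≡ca′ cb≡cb′ with linear record
    { verts    = a ∷ b ∷ a′ ∷ b′ ∷ []
    ; nonempty = λ ()
    ; distinct = (Adj⇒≢ G a~b ∷ a≢a′ ∷ a≢b′ ∷ []) ∷ (Adj⇒≢ G b~a′ ∷ b≢b′ ∷ [])
               ∷ (Adj⇒≢ G a′~b′ ∷ []) ∷ [] ∷ []
    ; linked   = a~b ∷ b~a′ ∷ a′~b′ ∷ [-]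
    }
    where
    a≢b′ : a ≢ b′
    a≢b′ refl = proper a~b (≡.sym cb≡cb′)
  ... | _ , here refl , unique = a≢a′ (≡.sym (unique a′ (there (there (here refl))) (≡.sym ca≡ca′)))
  ... | _ , there (here refl) , unique =
    b≢b′ (≡.sym (unique b′ (there (there (there (here refl)))) (≡.sym cb≡cb′)))
  ... | _ , there (there (here refl)) , unique = a≢a′ (unique a (here refl) ca≡ca′)
  ... | _ , there (there (there (here refl))) , unique = b≢b′ (unique b (there (here refl)) cb≡cb′)

module LinearColouringOfP3+P1-free
  (G : Graph) (free : P3+P1-free G) {c : V G → ℕ} (linear : IsLinear G c) where

  open LinearColouring G linear

  Twinned : V G → Set
  Twinned u = ∃[ u′ ] u′ ≢ u × c u′ ≡ c u

  twinned⇒neighbours-colour-distinct : ∀ {z y y′} → Twinned z → Adj G z y → Adj G z y′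
                                     → y ≢ y′ → c y ≢ c y′
  twinned⇒neighbours-colour-distinct {z} {y} {y′} (z′ , z′≢z , cz′≡cz) z~y z~y′ y≢y′ cy≡cy′ =
    free (induced-P3+P1 G (Adj-sym G z~y) z~y′ y≁y′ y≢y′ z′≁y z′≁z z′≁y′)
    where
    y≁y′ : ¬ Adj G y y′
    y≁y′ y~y′ = proper y~y′ cy≡cy′
    z′≁z : ¬ Adj G z′ z
    z′≁z z′~z = proper z′~z cz′≡cz
    z′≁y : ¬ Adj G z′ y
    z′≁y z′~y = no-ABAB-path (Adj-sym G z~y′) z~y (Adj-sym G z′~y) (≢-sym y≢y′) (≢-sym z′≢z)
                             (≡.sym cy≡cy′) (≡.sym cz′≡cz)
    z′≁y′ : ¬ Adj G z′ y′
    z′≁y′ z′~y′ = no-ABAB-path (Adj-sym G z~y) z~y′ (Adj-sym G z′~y′) y≢y′ (≢-sym z′≢z)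
                               cy≡cy′ (≡.sym cz′≡cz)

  twinned-Adj-trans : ∀ {u w t} → Twinned u → Twinned w → Twinned t
                    → Adj G u w → Adj G w t → u ≡ t ⊎ Adj G u t
  twinned-Adj-trans {u} {w} {t} twin-u (w′ , w′≢w , cw′≡cw) twin-t u~w w~t with u ≟ t | T? (adj G u t)
  ... | yes u≡t | _       = inj₁ u≡t
  ... | no _    | yes u~t = inj₂ u~t
  ... | no u≢t  | no u≁t  = contradiction (induced-P3+P1 G u~w w~t u≁t u≢t w′≁u w′≁w w′≁t) free
    where
    w′≁w : ¬ Adj G w′ w
    w′≁w w′~w = proper w′~w cw′≡cw
    w′≁u : ¬ Adj G w′ u
    w′≁u w′~u = twinned⇒neighbours-colour-distinct twin-u u~w (Adj-sym G w′~u)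
                  (≢-sym w′≢w) (≡.sym cw′≡cw)
    w′≁t : ¬ Adj G w′ t
    w′≁t w′~t = twinned⇒neighbours-colour-distinct twin-t (Adj-sym G w~t) (Adj-sym G w′~t)
                  (≢-sym w′≢w) (≡.sym cw′≡cw)

  twinned-walk⇒≡⊎Adj : (H : Subgraph G) → (∀ {v} → T (inV H v) → Twinned v)
                      → ∀ {u t} → T (inV H u) → T (inV H t) → Walk H u t → u ≡ t ⊎ Adj G u t
  twinned-walk⇒≡⊎Adj H twin u∈H t∈H stay = inj₁ refl
  twinned-walk⇒≡⊎Adj H twin u∈H t∈H (step e rest)
    with twinned-walk⇒≡⊎Adj H twin (step⇒inV H e) t∈H rest
  ... | inj₁ refl = inj₂ (step⇒Adj H e)
  ... | inj₂ w~t  = twinned-Adj-trans (twin u∈H) (twin (step⇒inV H e)) (twin t∈H) (step⇒Adj H e) w~t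

  linear⇒centered : IsCentered G c
  linear⇒centered H ((v , v∈H) , walk) = decidable-stable (hasUniqueColor? {G} c H?) λ ¬unique →
    let twin-in-H = ¬unique⇒twin {G} c H? ¬unique
        v′ , v′∈H , v′≢v , cv′≡cv = twin-in-H v∈H
    in  [ v′≢v ∘ ≡.sym , (λ v~v′ → proper v~v′ (≡.sym cv′≡cv)) ]
          (twinned-walk⇒≡⊎Adj H (map₂ proj₂ ∘ twin-in-H) v∈H v′∈H (walk v v′ v∈H v′∈H))
    where
    H? : Decidable (T ∘ inV H)
    H? = T? ∘ inV H

χlin≡χcen : (G : Graph) → (∀ c → IsLinear G c → IsCentered G c)
          → ∀ a b → IsChiLin G a → IsChiCen G b → a ≡ b
χlin≡χcen G linear⇒centered a b ((c , c-linear) , a-minimal) ((c′ , c′-centered) , b-minimal) =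
  ≤-antisym (a-minimal b c′ (centered⇒linear G c′-centered))
            (b-minimal a c (linear⇒centered _ c-linear))

theorem4p2 : (G : Graph) → P3+P1-free G
    → ((c : V G → ℕ) → IsLinear G c → IsCentered G c)
    × (∀ a b → IsChiLin G a → IsChiCen G b → a ≡ b)
theorem4p2 G free = linear⇒centered , χlin≡χcen G linear⇒centered
  where
  linear⇒centered : (c : V G → ℕ) → IsLinear G c → IsCentered G c
  linear⇒centered c = LinearColouringOfP3+P1-free.linear⇒centered G free
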